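{- Let $H\leq S_n$ be a transitive permutation group having the strict-EKR-property and admitting an element fixing exactly one point. Then the group $S_2\wr H$ has the strict-EKR-property.
   Context: For $G\leq\mathrm{Sym}(V)$ and $H\leq S_n$, the wreath product $G\wr H$ is the set of permutations $((g_1,\ldots,g_n),h)$ ($g_i\in G$, $h\in H$) of $V\times\{1,\ldots,n\}$ acting by $(a,i)\mapsto (g_i(a),h(i))$; here $S_2$ acts naturally on $\{1,2\}$. For a permutation group $K$ on $X$, a subset $I\subseteq K$ is intersecting if for all $g,h\in I$ there is $x\in X$ with $g(x)=h(x)$; $K$ has the strict-EKR-property if every maximum-size intersecting set is a coset of a point stabilizer. -}

module Defs where

open import Level using (0ℓ)
open import Data.Nat using (ℕ; _≤_)
open import Data.Fin using (Fin)
open import Data.Product using (Σ; ∃; _×_; _,_)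
open import Data.List using (List; length)
open import Data.List.Relation.Unary.All using (All)
open import Data.List.Relation.Unary.Any using (Any)
open import Data.List.Relation.Unary.AllPairs using (AllPairs)
open import Function.Bundles using (_⇔_)
open import Relation.Nullary using (¬_)
open import Relation.Binary.PropositionalEquality using (_≡_)

-- Maps of a set X; permutations are identified up to pointwise equality.
Map : Set → Set
Map X = X → X

_≐_ : {X : Set} → Map X → Map X → Set
f ≐ g = ∀ x → f x ≡ g x

_∘'_ : {X : Set} → Map X → Map X → Map X
(f ∘' g) x = f (g x)

idMap : {X : Set} → Map X
idMap x = x

IsBijection : {X : Set} → Map X → Set
IsBijection {X} f = Σ (Map X) λ g → (∀ x → g (f x) ≡ x) × (∀ x → f (g x) ≡ x)

record IsPermGroup {X : Set} (G : Map X → Set) : Set where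
  field
    resp  : ∀ {f g} → f ≐ g → G f → G g
    bij   : ∀ {f} → G f → IsBijection f
    has-id : G idMap
    comp  : ∀ {f g} → G f → G g → G (f ∘' g)
    inv   : ∀ {f} → G f → Σ (Map X) λ g → G g × (∀ x → g (f x) ≡ x) × (∀ x → f (g x) ≡ x)

Transitive : {X : Set} → (Map X → Set) → Set
Transitive {X} G = ∀ (x y : X) → Σ (Map X) λ g → G g × g x ≡ y

HasElementFixingExactlyOnePoint : {X : Set} → (Map X → Set) → Set
HasElementFixingExactlyOnePoint {X} G =
  Σ (Map X) λ g → G g × Σ X λ x → g x ≡ x × (∀ y → g y ≡ y → y ≡ x)

-- A finite subset of G: a duplicate-free (up to ≐) list of elements of G.
IsSubsetList : {X : Set} → (Map X → Set) → List (Map X) → Set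
IsSubsetList G I = All G I × AllPairs (λ f g → ¬ (f ≐ g)) I

_∈≐_ : {X : Set} → Map X → List (Map X) → Set
k ∈≐ I = Any (λ f → k ≐ f) I

IsIntersecting : {X : Set} → List (Map X) → Set
IsIntersecting {X} I = ∀ {f g} → f ∈≐ I → g ∈≐ I → Σ X λ x → f x ≡ g x

IntersectingSubset : {X : Set} → (Map X → Set) → List (Map X) → Set
IntersectingSubset G I = IsSubsetList G I × IsIntersecting I

MaximumIntersecting : {X : Set} → (Map X → Set) → List (Map X) → Set
MaximumIntersecting G I =
  IntersectingSubset G I × (∀ J → IntersectingSubset G J → length J ≤ length I)

-- I is (as a set) a coset g G_x = { k ∈ G : k x = g x } of a point stabilizer
-- (right cosets G_x g = { k ∈ G : k (g⁻¹ x) = x } have the same form).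
IsCosetOfPointStabilizer : {X : Set} → (Map X → Set) → List (Map X) → Set
IsCosetOfPointStabilizer {X} G I =
  Σ (Map X) λ g → G g × Σ X λ x →
    ∀ k → G k → (k ∈≐ I) ⇔ (k x ≡ g x)

StrictEKR : {X : Set} → (Map X → Set) → Set
StrictEKR {X} G = ∀ (I : List (Map X)) → MaximumIntersecting G I → IsCosetOfPointStabilizer G I

WreathS2 : {n : ℕ} → (Map (Fin n) → Set) → Map (Fin 2 × Fin n) → Set
WreathS2 {n} H k =
  Σ (Fin n → Map (Fin 2)) λ gs → (∀ i → IsBijection (gs i)) ×
  Σ (Map (Fin n)) λ h → H h ×
  (∀ a i → k (a , i) ≡ (gs i a , h i))

module Submission where

-- Write an element of S₂ ≀ H as k (c , i) = (bᵢ ⊕ c , h i), with base h ∈ H and flip vector b.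
-- Two elements of an intersecting family I agree somewhere, so an element of I is determined by
-- its base and its flips relative to the flip at 0; hence |I| ≤ |P| · 2ᵐ (n = m + 1), where the
-- set P of bases is intersecting in H.  Conversely every family M ⊆ H whose members all send x
-- to y lifts to an intersecting family of size |M| · 2ᵐ.  Comparing with a maximum intersecting family of H, which
-- is a coset by the EKR property, shows that P is maximum, hence P = {h : h x₀ = y₀}, and that I
-- realises every pair (base in P, relative flips).  Finally let u ∈ H fix only x₀ (a conjugate of
-- the given element, by transitivity).  For k ∈ I some k′ ∈ I has base (base k ∘ u), and k, k′
-- can only meet at x₀; this forces the flip at x₀ to be constant on I, so I is the coset of the
-- stabiliser of (0 , x₀).

open import Defs
open import Level using (Level; 0ℓ)
open import Data.Nat using (ℕ; zero; suc; _+_; _*_; _^_; _≤_; _<_; _≤?_)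
open import Data.Nat.Properties
  using (≤-trans; <⇒≱; ≮⇒≥; m≤m+n; +-suc; +-monoʳ-≤; *-cancelʳ-≤; m^n≢0; module ≤-Reasoning)
open import Data.Fin using (Fin; zero; suc)
open import Data.Fin.Properties using (≡-setoid; ≡-decSetoid)
open import Data.Product using (Σ; Σ-syntax; _×_; _,_; proj₁; proj₂)
open import Data.Product.Relation.Binary.Pointwise.NonDependent using (×-decSetoid)
open import Data.List
  using (List; []; _∷_; length; map; _++_; cartesianProductWith; cartesianProduct; allFin; deduplicate)
open import Data.List.Properties using (length-++; length-map; length-tabulate)
open import Data.List.Relation.Unary.All as All using (All; []; _∷_)
open import Data.List.Relation.Unary.Any as Any using (here; there)
open import Data.List.Relation.Unary.AllPairs as AllPairs using (AllPairs; []; _∷_)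
import Data.List.Relation.Unary.AllPairs.Properties as AllPairs
open import Data.List.Membership.Propositional using () renaming (_∈_ to _∈ₚ_)
open import Data.List.Membership.Propositional.Properties using (∈-allFin; ∈-cartesianProductWith⁻)
import Data.List.Membership.Setoid as Membership
import Data.List.Membership.Setoid.Properties as Membershipₚ
import Data.List.Membership.DecSetoid as DecMembership
import Data.List.Relation.Binary.Subset.Setoid as Subset
import Data.List.Relation.Unary.Unique.Setoid as Unique
import Data.List.Relation.Unary.Unique.Setoid.Properties as Uniqueₚ
open import Data.List.Relation.Unary.Unique.Propositional.Properties using (allFin⁺)
open import Data.List.Relation.Unary.Unique.DecSetoid.Properties using (deduplicate-!)
import Data.List.Fresh as List#
import Data.List.Fresh.Relation.Unary.Any as Any#
import Data.List.Fresh.Membership.Setoid as FreshMembership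
import Data.List.Fresh.Membership.Setoid.Properties as FreshMembershipₚ
import Data.Vec.Functional as Vec
import Data.Vec.Functional.Relation.Binary.Pointwise.Properties as Pointwise
open import Function using (_∘_; id; case_of_)
open import Function.Bundles using (Equivalence; mk⇔; _⇔_)
open import Relation.Binary.Bundles using (Setoid; DecSetoid)
open import Relation.Binary.PropositionalEquality
  using (_≡_; _≗_; refl; sym; trans; cong; cong₂; subst; subst₂; _→-setoid_; module ≡-Reasoning)
open import Relation.Nullary using (¬_; yes; no; contradiction)
open import Relation.Nullary.Decidable using (decidable-stable; ¬¬-excluded-middle)

private
  variable
    a c ℓ : Level
    A B C : Set a

module _ (S : Setoid c ℓ) where
  open Setoid S using (_≉_) renaming (Carrier to E)
  open Membership S using (_∈_; _∉_)
  open Subset S using (_⊆_)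
  open Unique S using (Unique)
  open FreshMembership S using () renaming (_∈_ to _∈#_)
  open FreshMembershipₚ S using (injection; strict-injection)

  private
    fresh : ∀ {xs} → Unique xs → List#.List# E _≉_
    fresh = List#.fromList

    length-fresh : ∀ {xs} (u : Unique xs) → List#.length (fresh u) ≡ length xs
    length-fresh [] = refl
    length-fresh (_ ∷ u) = cong suc (length-fresh u)

    ∈-fresh⁺ : ∀ {x xs} (u : Unique xs) → x ∈ xs → x ∈# fresh u
    ∈-fresh⁺ (_ ∷ u) (here p) = Any#.here p
    ∈-fresh⁺ (_ ∷ u) (there p) = Any#.there (∈-fresh⁺ u p)

    ∈-fresh⁻ : ∀ {x xs} (u : Unique xs) → x ∈# fresh u → x ∈ xs
    ∈-fresh⁻ (_ ∷ u) (Any#.here p) = here p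
    ∈-fresh⁻ (_ ∷ u) (Any#.there p) = there (∈-fresh⁻ u p)

  Unique-⊆⇒length≤ : ∀ {xs ys} → Unique xs → Unique ys → xs ⊆ ys → length xs ≤ length ys
  Unique-⊆⇒length≤ xs! ys! xs⊆ys = subst₂ _≤_ (length-fresh xs!) (length-fresh ys!)
    (injection id (∈-fresh⁺ ys! ∘ xs⊆ys ∘ ∈-fresh⁻ xs!))

  Unique-⊂⇒length< : ∀ {xs ys y} → Unique xs → Unique ys → xs ⊆ ys → y ∈ ys → y ∉ xs →
                     length xs < length ys
  Unique-⊂⇒length< xs! ys! xs⊆ys y∈ys y∉xs = subst₂ _<_ (length-fresh xs!) (length-fresh ys!)
    (strict-injection id (∈-fresh⁺ ys! ∘ xs⊆ys ∘ ∈-fresh⁻ xs!)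
      (_ , ∈-fresh⁺ ys! y∈ys , y∉xs ∘ ∈-fresh⁻ xs!))

module _ (S : DecSetoid c ℓ) where
  open DecSetoid S using (setoid)
  open DecMembership S using (_∈?_)
  open Subset setoid using (_⊆_)
  open Unique setoid using (Unique)

  Unique-⊆-length≥⇒⊇ : ∀ {xs ys} → Unique xs → Unique ys → xs ⊆ ys →
                       length ys ≤ length xs → ys ⊆ xs
  Unique-⊆-length≥⇒⊇ {xs} xs! ys! xs⊆ys ys≤xs {y} y∈ys = decidable-stable (y ∈? xs)
    λ y∉xs → <⇒≱ (Unique-⊂⇒length< setoid xs! ys! xs⊆ys y∈ys y∉xs) ys≤xs

length-cartesianProductWith : ∀ (f : A → B → C) xs ys →
  length (cartesianProductWith f xs ys) ≡ length xs * length ys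
length-cartesianProductWith f [] ys = refl
length-cartesianProductWith f (x ∷ xs) ys = begin
  length (map (f x) ys ++ cartesianProductWith f xs ys)
    ≡⟨ length-++ (map (f x) ys) ⟩
  length (map (f x) ys) + length (cartesianProductWith f xs ys)
    ≡⟨ cong₂ _+_ (length-map (f x) ys) (length-cartesianProductWith f xs ys) ⟩
  length ys + length xs * length ys
    ∎
  where open ≡-Reasoning

module _ {p} {A : Set a} (P : A → Set p) (size : A → ℕ) where

  Maximum : A → Set _
  Maximum x = P x × ∀ y → P y → size y ≤ size x

  ¬¬-maximum : ∀ d {x} → P x → (∀ y → P y → size y ≤ d + size x) → ¬ ¬ Σ A Maximum
  ¬¬-maximum zero px bounded = λ ¬max → ¬max (_ , px , bounded)
  ¬¬-maximum (suc d) {x} px bounded ¬max = ¬¬-excluded-middle {A = Bigger} λ where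
      (yes (y , py , x<y)) → ¬¬-maximum d py (λ z pz → ≤-trans (bounded z pz) (raise x<y)) ¬max
      (no ¬bigger) → ¬max (x , px , λ y py → ≮⇒≥ λ x<y → ¬bigger (y , py , x<y))
    where
      Bigger : Set _
      Bigger = Σ[ y ∈ A ] P y × size x < size y

      raise : ∀ {s} → size x < s → suc d + size x ≤ d + s
      raise {s} x<s = begin
        suc d + size x   ≡⟨ +-suc d (size x) ⟨
        d + suc (size x) ≤⟨ +-monoʳ-≤ d x<s ⟩
        d + s            ∎
        where open ≤-Reasoning

≗-decSetoid : ℕ → ℕ → DecSetoid 0ℓ 0ℓ
≗-decSetoid m k = Pointwise.decSetoid (≡-decSetoid k) m

≗-setoid : ∀ {m k} → Setoid 0ℓ 0ℓ
≗-setoid {m} {k} = DecSetoid.setoid (≗-decSetoid m k)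

allFunctions : ∀ m k → List (Fin m → Fin k)
allFunctions zero k = Vec.[] ∷ []
allFunctions (suc m) k = cartesianProductWith Vec._∷_ (allFin k) (allFunctions m k)

length-allFunctions : ∀ m k → length (allFunctions m k) ≡ k ^ m
length-allFunctions zero k = refl
length-allFunctions (suc m) k = begin
  length (allFunctions (suc m) k)
    ≡⟨ length-cartesianProductWith Vec._∷_ (allFin k) (allFunctions m k) ⟩
  length (allFin k) * length (allFunctions m k)
    ≡⟨ cong₂ _*_ (length-tabulate {n = k} id) (length-allFunctions m k) ⟩
  k * k ^ m
    ∎
  where open ≡-Reasoning

allFunctions-unique : ∀ m k → Unique.Unique (≗-setoid {m} {k}) (allFunctions m k)
allFunctions-unique zero k = [] ∷ []
allFunctions-unique (suc m) k = Uniqueₚ.cartesianProductWith⁺ (≡-setoid k) ≗-setoid ≗-setoid Vec._∷_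
  (λ eq → eq zero , eq ∘ suc) (allFin⁺ k) (allFunctions-unique m k)

∈-allFunctions : ∀ {m k} (f : Fin m → Fin k) → Membership._∈_ ≗-setoid f (allFunctions m k)
∈-allFunctions {zero} f = here (λ ())
∈-allFunctions {suc m} {k} f = Membershipₚ.∈-resp-≈ ≗-setoid head∷tail
  (Membershipₚ.∈-cartesianProductWith⁺ (≡-setoid k) ≗-setoid ≗-setoid ∷-cong
    (∈-allFin (f zero)) (∈-allFunctions (f ∘ suc)))
  where
    head∷tail : f zero Vec.∷ (f ∘ suc) ≗ f
    head∷tail zero = refl
    head∷tail (suc i) = refl
    ∷-cong : ∀ {c d} {u v : Fin m → Fin k} → c ≡ d → u ≗ v → c Vec.∷ u ≗ d Vec.∷ v
    ∷-cong c≡d u≗v zero = c≡d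
    ∷-cong c≡d u≗v (suc i) = u≗v i

Unique⇒length≤^ : ∀ {m k} {fs : List (Fin m → Fin k)} →
                  Unique.Unique ≗-setoid fs → length fs ≤ k ^ m
Unique⇒length≤^ {m} {k} {fs} fs! = subst (length fs ≤_) (length-allFunctions m k)
  (Unique-⊆⇒length≤ ≗-setoid fs! (allFunctions-unique m k) (λ {f} _ → ∈-allFunctions f))

infixl 6 _⊕_
_⊕_ : Fin 2 → Fin 2 → Fin 2
zero ⊕ c = c
suc zero ⊕ zero = suc zero
suc zero ⊕ suc zero = zero

⊕-identityʳ : ∀ a → a ⊕ zero ≡ a
⊕-identityʳ zero = refl
⊕-identityʳ (suc zero) = refl

⊕-self : ∀ a → a ⊕ a ≡ zero
⊕-self zero = refl
⊕-self (suc zero) = refl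

⊕-comm : ∀ a c → a ⊕ c ≡ c ⊕ a
⊕-comm zero zero = refl
⊕-comm zero (suc zero) = refl
⊕-comm (suc zero) zero = refl
⊕-comm (suc zero) (suc zero) = refl

⊕-inverseˡ : ∀ a c → a ⊕ (a ⊕ c) ≡ c
⊕-inverseˡ zero c = refl
⊕-inverseˡ (suc zero) zero = refl
⊕-inverseˡ (suc zero) (suc zero) = refl

⊕-cancelˡ : ∀ c {a b} → c ⊕ a ≡ c ⊕ b → a ≡ b
⊕-cancelˡ c {a} {b} eq = begin
  a           ≡⟨ sym (⊕-inverseˡ c a) ⟩
  c ⊕ (c ⊕ a) ≡⟨ cong (c ⊕_) eq ⟩
  c ⊕ (c ⊕ b) ≡⟨ ⊕-inverseˡ c b ⟩
  b           ∎
  where open ≡-Reasoning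

⊕-cancelʳ : ∀ c {a b} → a ⊕ c ≡ b ⊕ c → a ≡ b
⊕-cancelʳ c {a} {b} eq = ⊕-cancelˡ c (trans (⊕-comm c a) (trans eq (⊕-comm b c)))

≢⇒≡⊕1 : ∀ {a b : Fin 2} → ¬ a ≡ b → b ≡ a ⊕ suc zero
≢⇒≡⊕1 {zero} {zero} a≢b = contradiction refl a≢b
≢⇒≡⊕1 {zero} {suc zero} _ = refl
≢⇒≡⊕1 {suc zero} {zero} _ = refl
≢⇒≡⊕1 {suc zero} {suc zero} a≢b = contradiction refl a≢b

Fin2-bijection⇒translation : ∀ {f : Fin 2 → Fin 2} → IsBijection f → ∀ c → f c ≡ f zero ⊕ c
Fin2-bijection⇒translation {f} _ zero = sym (⊕-identityʳ (f zero))
Fin2-bijection⇒translation {f} (g , g∘f≗id , _) (suc zero) = ≢⇒≡⊕1 λ f0≡f1 → 0≢1 (begin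
  zero       ≡⟨ sym (g∘f≗id zero) ⟩
  g (f zero) ≡⟨ cong g f0≡f1 ⟩
  g (f (suc zero)) ≡⟨ g∘f≗id (suc zero) ⟩
  suc zero ∎)
  where
    open ≡-Reasoning
    0≢1 : ¬ Fin.zero {1} ≡ suc zero
    0≢1 ()

normaliseAt : ∀ {n} → Fin n → (Fin n → Fin 2) → Fin n → Fin 2
normaliseAt j b i = b i ⊕ b j

normaliseAt-injective : ∀ {n} {j l : Fin n} {b b′ : Fin n → Fin 2} →
  normaliseAt j b ≗ normaliseAt j b′ → b l ≡ b′ l → b ≗ b′
normaliseAt-injective {j = j} {l} {b} {b′} eq bl≡b′l i =
  ⊕-cancelʳ (b j) (trans (eq i) (cong (b′ i ⊕_) (sym bj≡b′j)))
  where
    bj≡b′j : b j ≡ b′ j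
    bj≡b′j = ⊕-cancelˡ (b l) (trans (eq l) (cong (_⊕ b′ j) (sym bl≡b′l)))

module PermutationGroup {X : Set} {H : Map X → Set} (H-group : IsPermGroup H) where
  open IsPermGroup H-group

  injective : ∀ {h} → H h → ∀ {x y} → h x ≡ h y → x ≡ y
  injective h∈H {x} {y} hx≡hy with bij h∈H
  ... | g , g∘h≗id , _ = trans (sym (g∘h≗id x)) (trans (cong g hx≡hy) (g∘h≗id y))

  FixesExactly : Map X → X → Set
  FixesExactly u x = u x ≡ x × ∀ y → u y ≡ y → y ≡ x

  conjugate-fixesExactly : Transitive H → HasElementFixingExactlyOnePoint H →
    ∀ x → Σ[ u ∈ Map X ] H u × FixesExactly u x
  conjugate-fixesExactly transitive (t , t∈H , z , tz≡z , t-fixes-only-z) x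
    with transitive z x
  ... | s , s∈H , sz≡x with inv s∈H
  ... | s⁻¹ , s⁻¹∈H , s⁻¹∘s≗id , s∘s⁻¹≗id =
    s ∘' (t ∘' s⁻¹) , comp s∈H (comp t∈H s⁻¹∈H) , ux≡x , u-fixes-only-x
    where
      s⁻¹x≡z : s⁻¹ x ≡ z
      s⁻¹x≡z = trans (cong s⁻¹ (sym sz≡x)) (s⁻¹∘s≗id z)
      ux≡x : s (t (s⁻¹ x)) ≡ x
      ux≡x = trans (cong (s ∘ t) s⁻¹x≡z) (trans (cong s tz≡z) sz≡x)
      u-fixes-only-x : ∀ y → s (t (s⁻¹ y)) ≡ y → y ≡ x
      u-fixes-only-x y uy≡y = begin
        y          ≡⟨ s∘s⁻¹≗id y ⟨
        s (s⁻¹ y)  ≡⟨ cong s (t-fixes-only-z (s⁻¹ y) ts⁻¹y≡s⁻¹y) ⟩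
        s z        ≡⟨ sz≡x ⟩
        x          ∎
        where
          open ≡-Reasoning
          ts⁻¹y≡s⁻¹y : t (s⁻¹ y) ≡ s⁻¹ y
          ts⁻¹y≡s⁻¹y = injective s∈H (trans uy≡y (sym (s∘s⁻¹≗id y)))

module _ {X : Set} where

  ≐-setoid : Setoid 0ℓ 0ℓ
  ≐-setoid = X →-setoid X

  lookup-∈≐ : ∀ {P : Map X → Set} {f L} → All P L → f ∈≐ L → Σ[ g ∈ Map X ] P g × f ≐ g
  lookup-∈≐ all f∈L = _ , All.lookupAny all f∈L

  ∈⇒∈≐ : ∀ {f : Map X} {L} → f ∈ₚ L → f ∈≐ L
  ∈⇒∈≐ = Any.map λ { refl x → refl }

  agreeingAt⇒intersecting : ∀ {L x y} → All (λ g → g x ≡ y) L → IsIntersecting L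
  agreeingAt⇒intersecting {x = x} all f∈L g∈L with lookup-∈≐ all f∈L | lookup-∈≐ all g∈L
  ... | _ , f′x≡y , f≐f′ | _ , g′x≡y , g≐g′ =
    x , trans (f≐f′ x) (trans f′x≡y (sym (trans (g≐g′ x) g′x≡y)))

  allPairs-tabulate : ∀ {R : Map X → Map X → Set} {L} →
                      (∀ {f g} → f ∈ₚ L → g ∈ₚ L → R f g) → AllPairs R L
  allPairs-tabulate {L = []} _ = []
  allPairs-tabulate {L = f ∷ L} R-on-L =
    All.tabulate (R-on-L (here refl) ∘ there) ∷ allPairs-tabulate λ f∈L g∈L → R-on-L (there f∈L) (there g∈L)

  nonempty⇒∈≐ : ∀ {L : List (Map X)} → 0 < length L → Σ[ f ∈ Map X ] f ∈≐ L
  nonempty⇒∈≐ {f ∷ _} _ = f , here (λ _ → refl)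

  coset⇒agreeing : ∀ {K : Map X → Set} {L} → All K L → IsCosetOfPointStabilizer K L →
    Σ[ x ∈ X ] Σ[ y ∈ X ] All (λ g → g x ≡ y) L
  coset⇒agreeing L⊆K (g , _ , x , coset) =
    x , g x , All.tabulate λ {f} f∈L → Equivalence.to (coset f (All.lookup L⊆K f∈L)) (∈⇒∈≐ f∈L)

module Wreath {m : ℕ} {H : Map (Fin (suc m)) → Set} (H-group : IsPermGroup H) where
  open IsPermGroup H-group

  n : ℕ
  n = suc m

  Point : Set
  Point = Fin 2 × Fin n

  G : Map Point → Set
  G = WreathS2 H

  base : Map Point → Map (Fin n)
  base k i = proj₂ (k (zero , i))

  flips : Map Point → Fin n → Fin 2
  flips k i = proj₁ (k (zero , i))

  wreath : Map (Fin n) → (Fin n → Fin 2) → Map Point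
  wreath h b (c , i) = b i ⊕ c , h i

  G⇒wreath : ∀ {k} → G k → k ≐ wreath (base k) (flips k)
  G⇒wreath {k} (gs , gs-bijective , h , _ , k≡) (c , i) = begin
    k (c , i)                          ≡⟨ k≡ c i ⟩
    gs i c , h i                       ≡⟨ cong (_, h i) (Fin2-bijection⇒translation (gs-bijective i) c) ⟩
    gs i zero ⊕ c , h i                ≡⟨ cong (λ p → proj₁ p ⊕ c , proj₂ p) (sym (k≡ zero i)) ⟩
    wreath (base k) (flips k) (c , i)  ∎
    where open ≡-Reasoning

  wreath∈G : ∀ {h} b → H h → G (wreath h b)
  wreath∈G b h∈H =
    (λ i → b i ⊕_) , (λ i → b i ⊕_ , ⊕-inverseˡ (b i) , ⊕-inverseˡ (b i)) , _ , h∈H , λ _ _ → refl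

  G-resp : ∀ {k k′} → k ≐ k′ → G k → G k′
  G-resp k≐k′ (gs , gs-bijective , h , h∈H , k≡) =
    gs , gs-bijective , h , h∈H , λ c i → trans (sym (k≐k′ (c , i))) (k≡ c i)

  base∈H : ∀ {k} → G k → H (base k)
  base∈H (_ , _ , _ , h∈H , k≡) = resp (λ i → sym (cong proj₂ (k≡ zero i))) h∈H

  wreath-agree : ∀ {h h′ b b′ c i} → wreath h b (c , i) ≡ wreath h′ b′ (c , i) →
                 h i ≡ h′ i × b i ≡ b′ i
  wreath-agree {c = c} eq = cong proj₂ eq , ⊕-cancelʳ c (cong proj₁ eq)

  G-agree : ∀ {k k′} → G k → G k′ → ∀ {c i} → k (c , i) ≡ k′ (c , i) →
            base k i ≡ base k′ i × flips k i ≡ flips k′ i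
  G-agree {k} {k′} k∈G k′∈G {c} {i} eq = wreath-agree {base k} {base k′} {flips k} {flips k′}
    (trans (sym (G⇒wreath k∈G (c , i))) (trans eq (G⇒wreath k′∈G (c , i))))

  G-ext : ∀ {k k′} → G k → G k′ → base k ≗ base k′ → flips k ≗ flips k′ → k ≐ k′
  G-ext k∈G k′∈G base≗ flips≗ (c , i) = begin
    _ ≡⟨ G⇒wreath k∈G (c , i) ⟩
    _ ≡⟨ cong₂ _,_ (cong (_⊕ c) (flips≗ i)) (base≗ i) ⟩
    _ ≡⟨ G⇒wreath k′∈G (c , i) ⟨
    _ ∎
    where open ≡-Reasoning

  relFlips : Map Point → Fin m → Fin 2
  relFlips k = normaliseAt zero (flips k) ∘ suc

  relFlips-injective : ∀ k k′ {l} → relFlips k ≗ relFlips k′ → flips k l ≡ flips k′ l →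
                       flips k ≗ flips k′
  relFlips-injective k k′ rel≗ = normaliseAt-injective λ where
    zero → trans (⊕-self (flips k zero)) (sym (⊕-self (flips k′ zero)))
    (suc i) → rel≗ i

  -- The flips are normalised to vanish at x, so all lifts of maps sending x to y send (0 , x) to (0 , y).
  liftAt : Fin n → Map (Fin n) → (Fin m → Fin 2) → Map Point
  liftAt x h a = wreath h (normaliseAt x (zero Vec.∷ a))

  liftAt-injective : ∀ {x h h′ a a′} → liftAt x h a ≐ liftAt x h′ a′ → h ≗ h′ × a ≗ a′
  liftAt-injective {x} {h} {h′} {a} {a′} eq = proj₁ ∘ agree , λ i →
    normaliseAt-injective {j = x} {l = zero} {b = zero Vec.∷ a} {zero Vec.∷ a′} (proj₂ ∘ agree) refl (suc i)
    where
      b = normaliseAt x (zero Vec.∷ a)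
      b′ = normaliseAt x (zero Vec.∷ a′)
      agree : ∀ i → h i ≡ h′ i × b i ≡ b′ i
      agree i = wreath-agree {h} {h′} {b} {b′} (eq (zero , i))

  liftAt-maps : ∀ {x y h} a → h x ≡ y → liftAt x h a (zero , x) ≡ (zero , y)
  liftAt-maps {x} a hx≡y = cong₂ _,_ (trans (⊕-identityʳ _) (⊕-self ((zero Vec.∷ a) x))) hx≡y

  lift-agreeing : ∀ {M x y} → Unique.Unique ≗-setoid M → All H M → All (λ h → h x ≡ y) M →
                  Σ[ L ∈ List (Map Point) ] IntersectingSubset G L × length L ≡ length M * 2 ^ m
  lift-agreeing {M} {x} {y} M! M⊆H M↦y = L , ((L⊆G , L!) , agreeingAt⇒intersecting L↦y) , length-L
    where
      L : List (Map Point)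
      L = cartesianProductWith (liftAt x) M (allFunctions m 2)

      L⊆G : All G L
      L⊆G = All.tabulate λ k∈L →
        case ∈-cartesianProductWith⁻ (liftAt x) M (allFunctions m 2) k∈L of λ where
          (h , a , h∈M , _ , refl) → wreath∈G _ (All.lookup M⊆H h∈M)

      L↦y : All (λ k → k (zero , x) ≡ (zero , y)) L
      L↦y = All.tabulate λ k∈L →
        case ∈-cartesianProductWith⁻ (liftAt x) M (allFunctions m 2) k∈L of λ where
          (h , a , h∈M , _ , refl) → liftAt-maps {x} {y} {h} a (All.lookup M↦y h∈M)

      L! : Unique.Unique ≐-setoid L
      L! = Uniqueₚ.cartesianProductWith⁺ ≗-setoid ≗-setoid ≐-setoid (liftAt x) (liftAt-injective {x})
        M! (allFunctions-unique m 2)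

      length-L : length L ≡ length M * 2 ^ m
      length-L = trans (length-cartesianProductWith (liftAt x) M (allFunctions m 2))
        (cong (length M *_) (length-allFunctions m 2))

  coords : Map Point → Map (Fin n) × (Fin m → Fin 2)
  coords k = base k , relFlips k

  Coords : DecSetoid 0ℓ 0ℓ
  Coords = ×-decSetoid (≗-decSetoid n n) (≗-decSetoid m 2)

  open DecSetoid Coords using () renaming (_≈_ to _≈ᶜ_; setoid to Coords-setoid)

  coords-injective : ∀ {k k′} → G k → G k′ → (Σ[ x ∈ Point ] k x ≡ k′ x) →
                     coords k ≈ᶜ coords k′ → k ≐ k′
  coords-injective {k} {k′} k∈G k′∈G (x , kx≡k′x) (base≗ , relFlips≗) =
    G-ext k∈G k′∈G base≗ (relFlips-injective k k′ relFlips≗ (proj₂ (G-agree k∈G k′∈G kx≡k′x)))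

  module MaximumIntersectingSet (transitive : Transitive H) (ekr : StrictEKR H)
    (fixer : HasElementFixingExactlyOnePoint H) {I : List (Map Point)}
    (I⊆G : All G I) (I! : Unique.Unique ≐-setoid I) (I-intersecting : IsIntersecting I)
    (I-maximum : ∀ J → IntersectingSubset G J → length J ≤ length I) where

    ∈I⇒∈G : ∀ {k} → k ∈≐ I → G k
    ∈I⇒∈G k∈I with lookup-∈≐ I⊆G k∈I
    ... | _ , k′∈G , k≐k′ = G-resp (λ x → sym (k≐k′ x)) k′∈G

    ∈I-agree : ∀ {k k′} → k ∈≐ I → k′ ∈≐ I →
               Σ[ i ∈ Fin n ] base k i ≡ base k′ i × flips k i ≡ flips k′ i
    ∈I-agree k∈I k′∈I with I-intersecting k∈I k′∈I
    ... | (_ , i) , kx≡k′x = i , G-agree (∈I⇒∈G k∈I) (∈I⇒∈G k′∈I) kx≡k′x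

    agreeing⇒|M|*2^m≤|I| : ∀ {M x y} → Unique.Unique ≗-setoid M → All H M → All (λ h → h x ≡ y) M →
                           length M * 2 ^ m ≤ length I
    agreeing⇒|M|*2^m≤|I| M! M⊆H M↦y with lift-agreeing M! M⊆H M↦y
    ... | L , L-intersecting , length-L = subst (_≤ length I) length-L (I-maximum L L-intersecting)

    P : List (Map (Fin n))
    P = deduplicate (DecSetoid._≟_ (≗-decSetoid n n)) (map base I)

    P! : Unique.Unique ≗-setoid P
    P! = deduplicate-! (≗-decSetoid n n) (map base I)

    base∈P : ∀ {k} → k ∈≐ I → Membership._∈_ ≗-setoid (base k) P
    base∈P k∈I = Membershipₚ.∈-deduplicate⁺ ≗-setoid _ (λ z≗y x≗y i → trans (x≗y i) (sym (z≗y i)))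
      (Membershipₚ.∈-map⁺ ≐-setoid ≗-setoid (λ k≐k′ i → cong proj₂ (k≐k′ (zero , i))) k∈I)

    ∈P⇒base : ∀ {h} → h ∈≐ P → Σ[ k ∈ Map Point ] k ∈≐ I × h ≗ base k
    ∈P⇒base h∈P = Membershipₚ.∈-map⁻ ≐-setoid ≗-setoid
      (Membershipₚ.∈-deduplicate⁻ ≗-setoid (DecSetoid._≟_ (≗-decSetoid n n)) (map base I) h∈P)

    P⊆H : All H P
    P⊆H = All.tabulate λ h∈P →
      let k , k∈I , h≗k = ∈P⇒base (∈⇒∈≐ h∈P) in resp (sym ∘ h≗k) (base∈H (∈I⇒∈G k∈I))

    P-intersecting : IsIntersecting P
    P-intersecting h∈P h′∈P =
      let k , k∈I , h≗k = ∈P⇒base h∈P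
          k′ , k′∈I , h′≗k′ = ∈P⇒base h′∈P
          i , base-agree , _ = ∈I-agree k∈I k′∈I
      in i , trans (h≗k i) (trans base-agree (sym (h′≗k′ i)))

    P×A : List (Map (Fin n) × (Fin m → Fin 2))
    P×A = cartesianProduct P (allFunctions m 2)

    P×A! : Unique.Unique Coords-setoid P×A
    P×A! = Uniqueₚ.cartesianProduct⁺ ≗-setoid ≗-setoid P! (allFunctions-unique m 2)

    length-P×A : length P×A ≡ length P * 2 ^ m
    length-P×A = trans (length-cartesianProductWith _,_ P (allFunctions m 2))
      (cong (length P *_) (length-allFunctions m 2))

    I-meeting : AllPairs (λ k k′ → G k × G k′ × Σ[ x ∈ Point ] k x ≡ k′ x) I
    I-meeting = allPairs-tabulate λ k∈I k′∈I →
      ∈I⇒∈G (∈⇒∈≐ k∈I) , ∈I⇒∈G (∈⇒∈≐ k′∈I) , I-intersecting (∈⇒∈≐ k∈I) (∈⇒∈≐ k′∈I)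

    coords-I! : Unique.Unique Coords-setoid (map coords I)
    coords-I! = AllPairs.map⁺ (AllPairs.zipWith
      (λ (k≉k′ , k∈G , k′∈G , k-meets-k′) → k≉k′ ∘ coords-injective k∈G k′∈G k-meets-k′)
      (I! , I-meeting))

    coords-I⊆P×A : Subset._⊆_ Coords-setoid (map coords I) P×A
    coords-I⊆P×A p∈coords-I with Membershipₚ.∈-map⁻ ≐-setoid Coords-setoid p∈coords-I
    ... | k , k∈I , p≈coords-k = Membershipₚ.∈-resp-≈ Coords-setoid (DecSetoid.sym Coords p≈coords-k)
      (Membershipₚ.∈-cartesianProduct⁺ ≗-setoid ≗-setoid (base∈P k∈I) (∈-allFunctions (relFlips k)))

    |I|≤|P|*2^m : length I ≤ length P * 2 ^ m
    |I|≤|P|*2^m = begin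
      length I              ≡⟨ length-map coords I ⟨
      length (map coords I) ≤⟨ Unique-⊆⇒length≤ Coords-setoid coords-I! P×A! coords-I⊆P×A ⟩
      length P×A            ≡⟨ length-P×A ⟩
      length P * 2 ^ m      ∎
      where open ≤-Reasoning

    -- A maximum intersecting family of H exists only classically (H is an arbitrary predicate),
    -- which suffices because the goal |J| ≤ |P| is decidable.
    P-maximum : MaximumIntersecting H P
    P-maximum = ((P⊆H , P!) , P-intersecting) , λ J J-intersecting →
      decidable-stable (length J ≤? length P) λ J≰P →
        ¬¬-maximum (IntersectingSubset H) length (n ^ n) (([] , []) , λ ())
          (λ J′ ((_ , J′!) , _) → ≤-trans (Unique⇒length≤^ J′!) (m≤m+n (n ^ n) 0))
          λ (M , M-maximum) → J≰P (≤-trans (proj₂ M-maximum J J-intersecting) (M≤P M M-maximum))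
      where
        M≤P : ∀ M → MaximumIntersecting H M → length M ≤ length P
        M≤P M M-maximum@(((M⊆H , M!) , _) , _) =
          let x , y , M↦y = coset⇒agreeing M⊆H (ekr M M-maximum)
          in *-cancelʳ-≤ (length M) (length P) (2 ^ m) {{m^n≢0 2 m}}
               (≤-trans (agreeing⇒|M|*2^m≤|I| M! M⊆H M↦y) |I|≤|P|*2^m)

    open PermutationGroup H-group using (injective; FixesExactly; conjugate-fixesExactly)

    x₀ : Fin n
    x₀ = proj₁ (proj₂ (proj₂ (ekr P P-maximum)))

    y₀ : Fin n
    y₀ = proj₁ (ekr P P-maximum) x₀

    P-coset : ∀ h → H h → h ∈≐ P ⇔ h x₀ ≡ y₀
    P-coset = proj₂ (proj₂ (proj₂ (ekr P P-maximum)))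

    P↦y₀ : All (λ h → h x₀ ≡ y₀) P
    P↦y₀ = All.tabulate λ h∈P → Equivalence.to (P-coset _ (All.lookup P⊆H h∈P)) (∈⇒∈≐ h∈P)

    base-x₀ : ∀ {k} → k ∈≐ I → base k x₀ ≡ y₀
    base-x₀ k∈I = Equivalence.to (P-coset _ (base∈H (∈I⇒∈G k∈I))) (base∈P k∈I)

    coords-surjective : ∀ {h} → H h → h x₀ ≡ y₀ → ∀ a →
      Σ[ k ∈ Map Point ] k ∈≐ I × base k ≗ h × relFlips k ≗ a
    coords-surjective h∈H hx₀≡y₀ a =
      let k , k∈I , (h≗base , a≗relFlips) = Membershipₚ.∈-map⁻ ≐-setoid Coords-setoid
            (Unique-⊆-length≥⇒⊇ Coords coords-I! P×A! coords-I⊆P×A |P×A|≤|coords-I|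
              (Membershipₚ.∈-cartesianProduct⁺ ≗-setoid ≗-setoid
                (Equivalence.from (P-coset _ h∈H) hx₀≡y₀) (∈-allFunctions a)))
      in k , k∈I , sym ∘ h≗base , sym ∘ a≗relFlips
      where
        |P×A|≤|coords-I| : length P×A ≤ length (map coords I)
        |P×A|≤|coords-I| = begin
          length P×A            ≡⟨ length-P×A ⟩
          length P * 2 ^ m      ≤⟨ agreeing⇒|M|*2^m≤|I| P! P⊆H P↦y₀ ⟩
          length I              ≡⟨ length-map coords I ⟨
          length (map coords I) ∎
          where open ≤-Reasoning

    module FlipsAtX₀ {u : Map (Fin n)} (u∈H : H u) (u-fixes-x₀ : FixesExactly u x₀) where

      -- k and k′ can only meet at a point fixed by u.
      flips-x₀-twisted : ∀ {k k′} → k ∈≐ I → k′ ∈≐ I → base k′ ≗ base k ∘ u →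
                         flips k x₀ ≡ flips k′ x₀
      flips-x₀-twisted {k} {k′} k∈I k′∈I base≗ =
        let i , base-agree , flips-agree = ∈I-agree k∈I k′∈I
            ui≡i = injective (base∈H (∈I⇒∈G k∈I)) (sym (trans base-agree (base≗ i)))
        in subst (λ j → flips k j ≡ flips k′ j) (proj₂ u-fixes-x₀ i ui≡i) flips-agree

      flips-x₀-fibre : ∀ {k k′} → k ∈≐ I → k′ ∈≐ I → base k′ ≗ base k →
                       flips k x₀ ≡ flips k′ x₀
      flips-x₀-fibre {k} {k′} k∈I k′∈I base≗ =
        let k″ , k″∈I , base-k″≗ , _ = coords-surjective (comp (base∈H (∈I⇒∈G k∈I)) u∈H)
              (trans (cong (base k) (proj₁ u-fixes-x₀)) (base-x₀ k∈I)) (relFlips k)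
        in trans (flips-x₀-twisted k∈I k″∈I base-k″≗)
             (sym (flips-x₀-twisted k′∈I k″∈I λ i → trans (base-k″≗ i) (sym (base≗ (u i)))))

      flips-x₀-constant : ∀ {k k′} → k ∈≐ I → k′ ∈≐ I → flips k x₀ ≡ flips k′ x₀
      flips-x₀-constant {k} {k′} k∈I k′∈I =
        let k″ , k″∈I , base-k″≗ , relFlips-k″≗ =
              coords-surjective (base∈H (∈I⇒∈G k′∈I)) (base-x₀ k′∈I) (relFlips k)
            _ , _ , flips-agree = ∈I-agree k∈I k″∈I
        in trans (relFlips-injective k k″ (sym ∘ relFlips-k″≗) flips-agree x₀)
                 (sym (flips-x₀-fibre k′∈I k″∈I base-k″≗))

    flips-x₀-constant : ∀ {k k′} → k ∈≐ I → k′ ∈≐ I → flips k x₀ ≡ flips k′ x₀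
    flips-x₀-constant =
      let _ , u∈H , u-fixes-x₀ = conjugate-fixesExactly transitive fixer x₀
      in FlipsAtX₀.flips-x₀-constant u∈H u-fixes-x₀

    ∈I⇔agreesAt-x₀ : ∀ {k₀} → k₀ ∈≐ I → ∀ k → G k → k ∈≐ I ⇔ k (zero , x₀) ≡ k₀ (zero , x₀)
    ∈I⇔agreesAt-x₀ {k₀} k₀∈I k k∈G = mk⇔ ∈I⇒agrees agrees⇒∈I
      where
        ∈I⇒agrees : k ∈≐ I → k (zero , x₀) ≡ k₀ (zero , x₀)
        ∈I⇒agrees k∈I =
          cong₂ _,_ (flips-x₀-constant k∈I k₀∈I) (trans (base-x₀ k∈I) (sym (base-x₀ k₀∈I)))

        agrees⇒∈I : k (zero , x₀) ≡ k₀ (zero , x₀) → k ∈≐ I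
        agrees⇒∈I k↦≡k₀↦ =
          let k′ , k′∈I , base-k′≗ , relFlips-k′≗ =
                coords-surjective (base∈H k∈G) (trans (cong proj₂ k↦≡k₀↦) (base-x₀ k₀∈I)) (relFlips k)
              flips-x₀≡ = trans (cong proj₁ k↦≡k₀↦) (flips-x₀-constant k₀∈I k′∈I)
              k≐k′ = G-ext k∈G (∈I⇒∈G k′∈I) (sym ∘ base-k′≗)
                       (relFlips-injective k k′ (sym ∘ relFlips-k′≗) flips-x₀≡)
          in Membershipₚ.∈-resp-≈ ≐-setoid (sym ∘ k≐k′) k′∈I

    I-nonempty : Σ[ k₀ ∈ Map Point ] k₀ ∈≐ I
    I-nonempty = nonempty⇒∈≐ (I-maximum (idMap ∷ []) ((id∈G ∷ [] , [] ∷ []) , id-intersecting))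
      where
        id∈G : G idMap
        id∈G = wreath∈G (λ _ → zero) has-id

        id-intersecting : IsIntersecting (idMap ∷ [])
        id-intersecting = agreeingAt⇒intersecting {x = zero , zero} (refl ∷ [])

    I-coset : IsCosetOfPointStabilizer G I
    I-coset = let k₀ , k₀∈I = I-nonempty in k₀ , ∈I⇒∈G k₀∈I , (zero , x₀) , ∈I⇔agreesAt-x₀ k₀∈I

lemma4p12 : (n : ℕ) (H : Map (Fin n) → Set) → IsPermGroup H → Transitive H → StrictEKR H →
            HasElementFixingExactlyOnePoint H → StrictEKR (WreathS2 H)
lemma4p12 zero H _ _ _ (_ , _ , () , _)
lemma4p12 (suc m) H H-group transitive ekr fixer I (((I⊆G , I!) , I-intersecting) , I-maximum) =
  MaximumIntersectingSet.I-coset transitive ekr fixer I⊆G I! I-intersecting I-maximum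
  where open Wreath H-group
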